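{- Let $N = p^k m^2$ be an odd perfect number, where $p$ is a prime with $p \equiv k \equiv 1 \pmod 4$, $k$ a positive integer, $m$ a positive integer and $\gcd(p,m)=1$. Set $\rho_3 = \sigma(p^k)/m$ and $\mu_4 = \sigma(m)/p^k$. Then $\rho_3 \neq \mu_4$, and: (i) if $\rho_3 < 1$, then $p^k < m$; (ii) if $1 < \rho_3$ and $\rho_3 < \mu_4$, then $\frac{4}{5}m < p^k < \sqrt{2}\,m$; (iii) if $1 < \rho_3$ and $\mu_4 < \rho_3$, then $m < p^k$.
   Context: $\sigma(n)$ denotes the sum of the positive divisors of $n$. An odd perfect number is an odd positive integer $N$ with $\sigma(N)=2N$. -}

module Defs where

open import Data.Nat using (ℕ; zero; suc; _+_; _*_; _^_; _≤_; _<_; NonZero; >-nonZero)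
open import Data.Nat.Divisibility using (_∣?_)
open import Data.Nat.ListAction using (sum)
open import Data.List using (List; filter; upTo; map)
open import Data.Integer using (+_)
open import Data.Rational using (ℚ; _/_)
open import Data.Nat.Properties using (m^n>0)
open import Data.Nat.Primality using (Prime; prime⇒nonZero)

σ : ℕ → ℕ
σ n = sum (filter (λ d → d ∣? n) (map suc (upTo n)))

_÷ℕ_[_] : ℕ → (d : ℕ) → 0 < d → ℚ
a ÷ℕ d [ pos ] = (+ a) / d
  where instance _ = >-nonZero pos

ℕtoℚ : ℕ → ℚ
ℕtoℚ a = (+ a) / 1

ρ₃ : (p k m : ℕ) → 0 < m → ℚ
ρ₃ p k m mpos = σ (p ^ k) ÷ℕ m [ mpos ]

μ₄ : (p k m : ℕ) → Prime p → ℚ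
μ₄ p k m pp = σ m ÷ℕ (p ^ k) [ m^n>0 p k ]
  where instance _ = prime⇒nonZero pp

{-# OPTIONS --safe #-}
module Submission where

-- Put q = p ^ k. Multiplicativity of σ turns perfection of N into σ(q) σ(m²) = 2 q m², and ρ₃, μ₄
-- compare as the integers σ(q) q and σ(m) m. The estimates used are q < σ(q) < (5/4) q (as p ≥ 5),
-- m σ(m) ≤ σ(m²) ≤ σ(m)², and σ(m²) < 2 m², which follows from q < σ(q).
-- If ρ₃ = μ₄, coprimality forces (σ(q), σ(m)) = t (m, q): t = 0 and t = 1 contradict q < σ(q) and
-- m ≤ σ(m), while t ≥ 2 gives σ(N) ≥ σ(q) m σ(m) = t² N ≥ 4N.
-- In case (ii), q² < σ(q) q < σ(m) m ≤ σ(m²) < 2 m². In case (iii), q ≤ m would make both σ(q)/q and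
-- σ(m)/m smaller than 5/4, and then σ(N) ≤ σ(q) σ(m)² < (5/4)³ N < 2N.

open import Defs
open import Data.Nat using (ℕ; _*_; _^_; _%_)
open import Data.Nat.Primality using (Prime)
open import Data.Nat.Coprimality using (Coprime)
open import Data.Rational using (ℚ; 1ℚ)
open import Data.Rational using (toℚᵘ)
open import Data.Integer using (+_)
open import Data.Product using (_×_)
open import Relation.Binary.PropositionalEquality using (_≡_; _≢_)
import Data.Nat as N
import Data.Rational as Q

open import Data.Nat using (zero; suc; _+_; _≤_; _<_; z≤n; s≤s; z<s; NonZero; >-nonZero; >-nonZero⁻¹; ≢-nonZero⁻¹; nonTrivial⇒n>1)
open import Data.Nat.Properties
open import Data.Nat.Divisibility
  using (_∣_; _∣?_; divides; ∣-refl; ∣-trans; ∣-antisym; 1∣_; ∣1⇒≡1; 0∣⇒≡0; ∣⇒≤; m∣m*n; *-pres-∣; *-monoʳ-∣; *-cancelˡ-∣)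
open import Data.Nat.DivMod using (_/_; m*[n/m]≡n)
open import Data.Nat.GCD using (gcd; gcd[m,n]∣m; gcd[m,n]∣n; gcd[m,n]≢0)
open import Data.Nat.Coprimality using (coprime-/gcd; coprime-divisor)
import Data.Nat.Coprimality as Coprime
open import Data.Nat.Primality using (prime⇒nonZero; prime⇒nonTrivial; prime⇒irreducible)
open import Data.Nat.ListAction using (sum)
open import Data.Nat.ListAction.Properties using (sum-++; sum-↭)
open import Data.Nat.Solver using (module +-*-Solver)
open import Data.List using (List; []; _∷_; _++_; map; filter; upTo; cartesianProduct; cartesianProductWith)
open import Data.List.Properties using (map-++; map-∘)
open import Data.List.Membership.Propositional using (_∈_)
open import Data.List.Membership.Propositional.Properties
  using (∈-∃++; ∈-map⁺; ∈-map⁻; ∈-filter⁺; ∈-filter⁻; ∈-upTo⁺; ∈-cartesianProductWith⁺; ∈-cartesianProductWith⁻; ∈-cartesianProduct⁻)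
open import Data.List.Relation.Binary.Subset.Propositional using (_⊆_)
open import Data.List.Relation.Binary.Permutation.Propositional using (↭-sym)
open import Data.List.Relation.Binary.Permutation.Propositional.Properties using (shift; ∈-resp-↭)
open import Data.List.Relation.Unary.Any using (here; there)
import Data.List.Relation.Unary.All as All
import Data.List.Relation.Unary.All.Properties as All
open import Data.List.Relation.Unary.AllPairs using ([]; _∷_)
open import Data.List.Relation.Unary.Unique.Propositional using (Unique)
import Data.List.Relation.Unary.Unique.Propositional.Properties as Unique
open import Data.Product using (∃; ∃₂; _,_; proj₂; uncurry)
open import Data.Sum using (inj₁; inj₂)
open import Relation.Binary.PropositionalEquality using (refl; sym; trans; cong; cong₂; subst; subst₂; module ≡-Reasoning)
open import Relation.Nullary using (yes; no; contradiction)
open import Data.Empty using (⊥)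
import Data.Integer as ℤ
import Data.Integer.Properties as ℤ
open import Data.Rational.Properties using (toℚᵘ-fromℚᵘ; toℚᵘ-cong; toℚᵘ-mono-<; toℚᵘ-cancel-<; toℚᵘ-homo-*; toℚᵘ-injective)
open import Data.Rational.Unnormalised using (mkℚᵘ; *<*; *≡*) renaming (_≃_ to _≃ᵘ_)
import Data.Rational.Unnormalised.Properties as ℚᵘ

open +-*-Solver

sum-mono-⊆ : ∀ {xs ys : List ℕ} → Unique xs → xs ⊆ ys → sum xs ≤ sum ys
sum-mono-⊆ {[]} _ _ = z≤n
sum-mono-⊆ {x ∷ xs} (x∉xs ∷ xs!) xs⊆ys with ∈-∃++ (xs⊆ys (here refl))
... | us , vs , refl = begin
  x + sum xs         ≤⟨ +-monoʳ-≤ x (sum-mono-⊆ xs! xs⊆us++vs) ⟩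
  sum (x ∷ us ++ vs) ≡⟨ sum-↭ (↭-sym (shift x us vs)) ⟩
  sum (us ++ x ∷ vs) ∎
  where
  open ≤-Reasoning
  xs⊆us++vs : xs ⊆ us ++ vs
  xs⊆us++vs y∈xs with ∈-resp-↭ (shift x us vs) (xs⊆ys (there y∈xs))
  ... | here y≡x = contradiction (sym y≡x) (All.lookup x∉xs y∈xs)
  ... | there y∈ = y∈

map⁺-injectiveOn : ∀ {A B : Set} {f : A → B} {xs} →
  (∀ {x y} → x ∈ xs → y ∈ xs → f x ≡ f y → x ≡ y) → Unique xs → Unique (map f xs)
map⁺-injectiveOn {xs = []} _ [] = []
map⁺-injectiveOn {xs = x ∷ xs} f-inj (x∉xs ∷ xs!) =
  All.map⁺ (All.tabulate λ y∈xs fx≡fy → All.lookup x∉xs y∈xs (f-inj (here refl) (there y∈xs) fx≡fy))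
  ∷ map⁺-injectiveOn (λ x∈xs y∈xs → f-inj (there x∈xs) (there y∈xs)) xs!

map-uncurry-cartesianProduct : ∀ {A B C : Set} (f : A → B → C) xs ys →
  map (uncurry f) (cartesianProduct xs ys) ≡ cartesianProductWith f xs ys
map-uncurry-cartesianProduct f [] ys = refl
map-uncurry-cartesianProduct f (x ∷ xs) ys = begin
  map (uncurry f) (map (x ,_) ys ++ cartesianProduct xs ys)
    ≡⟨ map-++ (uncurry f) (map (x ,_) ys) (cartesianProduct xs ys) ⟩
  map (uncurry f) (map (x ,_) ys) ++ map (uncurry f) (cartesianProduct xs ys)
    ≡⟨ cong₂ _++_ (sym (map-∘ ys)) (map-uncurry-cartesianProduct f xs ys) ⟩
  map (f x) ys ++ cartesianProductWith f xs ys ∎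
  where open ≡-Reasoning

sum-map-* : ∀ m ns → sum (map (m *_) ns) ≡ m * sum ns
sum-map-* m [] = sym (*-zeroʳ m)
sum-map-* m (n ∷ ns) = trans (cong (_+_ (m * n)) (sum-map-* m ns)) (sym (*-distribˡ-+ m n (sum ns)))

sum-cartesianProductWith-* : ∀ ms ns → sum (cartesianProductWith _*_ ms ns) ≡ sum ms * sum ns
sum-cartesianProductWith-* [] ns = refl
sum-cartesianProductWith-* (m ∷ ms) ns = begin
  sum (map (m *_) ns ++ cartesianProductWith _*_ ms ns)
    ≡⟨ sum-++ (map (m *_) ns) (cartesianProductWith _*_ ms ns) ⟩
  sum (map (m *_) ns) + sum (cartesianProductWith _*_ ms ns)
    ≡⟨ cong₂ _+_ (sum-map-* m ns) (sum-cartesianProductWith-* ms ns) ⟩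
  m * sum ns + sum ms * sum ns
    ≡⟨ sym (*-distribʳ-+ (sum ns) m (sum ms)) ⟩
  (m + sum ms) * sum ns ∎
  where open ≡-Reasoning

coprime-* : ∀ {a b c} → Coprime a b → Coprime a c → Coprime a (b * c)
coprime-* a⊥b a⊥c (d∣a , d∣bc) =
  a⊥c (d∣a , coprime-divisor (λ (e∣d , e∣b) → a⊥b (∣-trans e∣d d∣a , e∣b)) d∣bc)

coprime-^ : ∀ {a b} k → Coprime a b → Coprime a (b ^ k)
coprime-^ zero _ (_ , d∣1) = ∣1⇒≡1 d∣1
coprime-^ (suc k) a⊥b = coprime-* a⊥b (coprime-^ k a⊥b)

coprime-∣ : ∀ {a b d e} → Coprime a b → d ∣ a → e ∣ b → Coprime d e
coprime-∣ a⊥b d∣a e∣b (x∣d , x∣e) = a⊥b (∣-trans x∣d d∣a , ∣-trans x∣e e∣b)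

coprime-proportional : ∀ {a b m q} .{{_ : NonZero m}} → Coprime m q →
  a * q ≡ b * m → ∃ λ t → a ≡ t * m × b ≡ t * q
coprime-proportional {a} {b} {m} {q} m⊥q aq≡bm = t , a≡tm , b≡tq
  where
  m∣a : m ∣ a
  m∣a = coprime-divisor m⊥q (divides b (trans (*-comm q a) aq≡bm))
  t = _∣_.quotient m∣a
  a≡tm = _∣_.equality m∣a
  b≡tq : b ≡ t * q
  b≡tq = *-cancelʳ-≡ b (t * q) m (begin
    b * m     ≡⟨ sym aq≡bm ⟩
    a * q     ≡⟨ cong (_* q) a≡tm ⟩
    t * m * q ≡⟨ solve 3 (λ t m q → t :* m :* q := t :* q :* m) refl t m q ⟩
    t * q * m ∎)
    where open ≡-Reasoning

coprime-*-injective : ∀ {d e d′ e′} → Coprime d e′ → Coprime d′ e →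
  d * e ≡ d′ * e′ → d ≡ d′ × e ≡ e′
coprime-*-injective {d} {e} {d′} {e′} d⊥e′ d′⊥e de≡d′e′ =
  ∣-antisym (cancel d⊥e′ de≡d′e′) (cancel d′⊥e (sym de≡d′e′)) ,
  ∣-antisym (cancel (Coprime.sym d′⊥e) ed≡e′d′) (cancel (Coprime.sym d⊥e′) (sym ed≡e′d′))
  where
  cancel : ∀ {x y x′ y′} → Coprime x y′ → x * y ≡ x′ * y′ → x ∣ x′
  cancel {x} {y} {x′} {y′} x⊥y′ xy≡x′y′ =
    coprime-divisor x⊥y′ (subst (x ∣_) (trans xy≡x′y′ (*-comm x′ y′)) (m∣m*n y))
  ed≡e′d′ : e * d ≡ e′ * d′
  ed≡e′d′ = trans (*-comm e d) (trans de≡d′e′ (*-comm d′ e′))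

-- With g = gcd c a, c / g is coprime to a / g and divides (a / g) * b.
∣-*-split : ∀ {c} a b .{{_ : NonZero a}} → c ∣ a * b → ∃₂ λ d e → d ∣ a × e ∣ b × c ≡ d * e
∣-*-split {c} a b c∣ab = g , c / g , gcd[m,n]∣n c a , c/g∣b , sym (m*[n/m]≡n (gcd[m,n]∣m c a))
  where
  g = gcd c a
  instance _ = >-nonZero (n≢0⇒n>0 (gcd[m,n]≢0 c a (inj₂ (≢-nonZero⁻¹ a))))
  c/g∣b : c / g ∣ b
  c/g∣b = coprime-divisor (coprime-/gcd c a) (*-cancelˡ-∣ g (subst₂ _∣_
    (sym (m*[n/m]≡n (gcd[m,n]∣m c a)))
    (trans (cong (_* b) (sym (m*[n/m]≡n (gcd[m,n]∣n c a)))) (*-assoc g (a / g) b))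
    c∣ab))

divisors : ℕ → List ℕ
divisors n = filter (_∣? n) (map suc (upTo n))

unique-divisors : ∀ n → Unique (divisors n)
unique-divisors n = Unique.filter⁺ (_∣? n) (Unique.map⁺ suc-injective (Unique.upTo⁺ n))

∈-divisors⁻ : ∀ {d} n → d ∈ divisors n → d ∣ n
∈-divisors⁻ n d∈ = proj₂ (∈-filter⁻ (_∣? n) {xs = map suc (upTo n)} d∈)

∈-divisors⁺ : ∀ {d n} .{{_ : NonZero n}} → d ∣ n → d ∈ divisors n
∈-divisors⁺ {zero} {n} 0∣n = contradiction (0∣⇒≡0 0∣n) (≢-nonZero⁻¹ n)
∈-divisors⁺ {suc d} {n} d∣n = ∈-filter⁺ (_∣? n) (∈-map⁺ suc (∈-upTo⁺ (∣⇒≤ d∣n))) d∣n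

n≤σ[n] : ∀ n .{{_ : NonZero n}} → n ≤ σ n
n≤σ[n] n = subst (_≤ σ n) (+-identityʳ n)
  (sum-mono-⊆ (All.[] ∷ []) λ { (here refl) → ∈-divisors⁺ ∣-refl })

n<σ[n] : ∀ {n} → 1 < n → n < σ n
n<σ[n] {n} 1<n = subst (_≤ σ n) (cong suc (+-identityʳ n))
  (sum-mono-⊆ ((<⇒≢ 1<n All.∷ All.[]) ∷ All.[] ∷ [])
    λ { (here refl) → ∈-divisors⁺ (1∣ n) ; (there (here refl)) → ∈-divisors⁺ ∣-refl })
  where instance _ = >-nonZero (<-trans z<s 1<n)

m*σ[n]≤σ[m*n] : ∀ m n .{{_ : NonZero m}} .{{_ : NonZero n}} → m * σ n ≤ σ (m * n)
m*σ[n]≤σ[m*n] m n = begin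
  m * σ n                ≡⟨ sum-map-* m (divisors n) ⟨
  sum (map (m *_) (divisors n))
    ≤⟨ sum-mono-⊆ (Unique.map⁺ (λ {x} {y} → *-cancelˡ-≡ x y m) (unique-divisors n)) multiples⊆ ⟩
  σ (m * n)              ∎
  where
  open ≤-Reasoning
  instance _ = m*n≢0 m n
  multiples⊆ : map (m *_) (divisors n) ⊆ divisors (m * n)
  multiples⊆ c∈ with ∈-map⁻ (m *_) c∈
  ... | d , d∈ , refl = ∈-divisors⁺ (*-monoʳ-∣ m (∈-divisors⁻ n d∈))

σ[m*n]≤σ[m]*σ[n] : ∀ m n .{{_ : NonZero m}} .{{_ : NonZero n}} → σ (m * n) ≤ σ m * σ n
σ[m*n]≤σ[m]*σ[n] m n = begin
  σ (m * n)                                                ≤⟨ sum-mono-⊆ (unique-divisors (m * n)) ⊆products ⟩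
  sum (cartesianProductWith _*_ (divisors m) (divisors n)) ≡⟨ sum-cartesianProductWith-* (divisors m) (divisors n) ⟩
  σ m * σ n                                                ∎
  where
  open ≤-Reasoning
  ⊆products : divisors (m * n) ⊆ cartesianProductWith _*_ (divisors m) (divisors n)
  ⊆products c∈ with ∣-*-split m n (∈-divisors⁻ (m * n) c∈)
  ... | d , e , d∣m , e∣n , refl = ∈-cartesianProductWith⁺ _*_ (∈-divisors⁺ d∣m) (∈-divisors⁺ e∣n)

σ[m]*σ[n]≤σ[m*n] : ∀ {m n} .{{_ : NonZero m}} .{{_ : NonZero n}} → Coprime m n → σ m * σ n ≤ σ (m * n)
σ[m]*σ[n]≤σ[m*n] {m} {n} m⊥n = begin
  σ m * σ n                                                ≡⟨ sum-cartesianProductWith-* (divisors m) (divisors n) ⟨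
  sum (cartesianProductWith _*_ (divisors m) (divisors n)) ≤⟨ sum-mono-⊆ products! products⊆ ⟩
  σ (m * n)                                                ∎
  where
  open ≤-Reasoning
  instance _ = m*n≢0 m n
  *-injectiveOn : ∀ {x y} → x ∈ cartesianProduct (divisors m) (divisors n) →
    y ∈ cartesianProduct (divisors m) (divisors n) → uncurry _*_ x ≡ uncurry _*_ y → x ≡ y
  *-injectiveOn {d , e} {d′ , e′} x∈ y∈ de≡d′e′
    with d∈ , e∈ ← ∈-cartesianProduct⁻ (divisors m) (divisors n) x∈
       | d′∈ , e′∈ ← ∈-cartesianProduct⁻ (divisors m) (divisors n) y∈
    with refl , refl ← coprime-*-injective
           (coprime-∣ m⊥n (∈-divisors⁻ m d∈) (∈-divisors⁻ n e′∈))
           (coprime-∣ m⊥n (∈-divisors⁻ m d′∈) (∈-divisors⁻ n e∈)) de≡d′e′ = refl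
  products! : Unique (cartesianProductWith _*_ (divisors m) (divisors n))
  products! = subst Unique (map-uncurry-cartesianProduct _*_ (divisors m) (divisors n))
    (map⁺-injectiveOn *-injectiveOn (Unique.cartesianProduct⁺ (unique-divisors m) (unique-divisors n)))
  products⊆ : cartesianProductWith _*_ (divisors m) (divisors n) ⊆ divisors (m * n)
  products⊆ c∈ with ∈-cartesianProductWith⁻ _*_ (divisors m) (divisors n) c∈
  ... | d , e , d∈ , e∈ , refl = ∈-divisors⁺ (*-pres-∣ (∈-divisors⁻ m d∈) (∈-divisors⁻ n e∈))

σ-multiplicative : ∀ {m n} .{{_ : NonZero m}} .{{_ : NonZero n}} → Coprime m n → σ (m * n) ≡ σ m * σ n
σ-multiplicative {m} {n} m⊥n = ≤-antisym (σ[m*n]≤σ[m]*σ[n] m n) (σ[m]*σ[n]≤σ[m*n] {m} {n} m⊥n)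

powers : ℕ → ℕ → List ℕ
powers p zero = 1 ∷ []
powers p (suc k) = 1 ∷ map (p *_) (powers p k)

∣p^k⇒∈powers : ∀ {p d} k → Prime p → d ∣ p ^ k → d ∈ powers p k
∣p^k⇒∈powers zero _ d∣1 = here (∣1⇒≡1 d∣1)
∣p^k⇒∈powers {p} {d} (suc k) pp d∣p^k with p ∣? d
... | yes (divides q refl) = there (subst (_∈ map (p *_) (powers p k)) (*-comm p q)
        (∈-map⁺ (p *_) (∣p^k⇒∈powers k pp q∣p^k)))
  where q∣p^k = *-cancelˡ-∣ p {{prime⇒nonZero pp}} (subst (_∣ p * p ^ k) (*-comm q p) d∣p^k)
... | no p∤d = here (coprime-^ (suc k) d⊥p (∣-refl , d∣p^k))
  where
  d⊥p : Coprime d p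
  d⊥p (x∣d , x∣p) with prime⇒irreducible pp x∣p
  ... | inj₁ x≡1 = x≡1
  ... | inj₂ refl = contradiction x∣d p∤d

4*sum-powers<5*p^k : ∀ {p} k → 5 ≤ p → 4 * sum (powers p k) < 5 * p ^ k
4*sum-powers<5*p^k zero _ = ≤-refl
4*sum-powers<5*p^k {p} (suc k) 5≤p = begin
  suc (4 * (1 + sum (map (p *_) (powers p k))))
    ≡⟨ cong (λ s → suc (4 * (1 + s))) (sum-map-* p (powers p k)) ⟩
  suc (4 * (1 + p * S))
    ≡⟨ solve 2 (λ p s → con 1 :+ con 4 :* (con 1 :+ p :* s) := con 5 :+ p :* (con 4 :* s)) refl p S ⟩
  5 + p * (4 * S)        ≤⟨ +-monoˡ-≤ (p * (4 * S)) 5≤p ⟩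
  p + p * (4 * S)        ≡⟨ *-suc p (4 * S) ⟨
  p * suc (4 * S)        ≤⟨ *-monoʳ-≤ p (4*sum-powers<5*p^k k 5≤p) ⟩
  p * (5 * p ^ k)        ≡⟨ solve 2 (λ p r → p :* (con 5 :* r) := con 5 :* (p :* r)) refl p (p ^ k) ⟩
  5 * (p * p ^ k)        ∎
  where
  open ≤-Reasoning
  S = sum (powers p k)

4*σ[p^k]<5*p^k : ∀ {p} k → Prime p → 5 ≤ p → 4 * σ (p ^ k) < 5 * p ^ k
4*σ[p^k]<5*p^k {p} k pp 5≤p = ≤-<-trans
  (*-monoʳ-≤ 4 (sum-mono-⊆ (unique-divisors (p ^ k)) λ d∈ → ∣p^k⇒∈powers k pp (∈-divisors⁻ (p ^ k) d∈)))
  (4*sum-powers<5*p^k k 5≤p)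

n%4≡1⇒5≤n : ∀ {n} → 1 < n → n % 4 ≡ 1 → 5 ≤ n
n%4≡1⇒5≤n {0} () _
n%4≡1⇒5≤n {1} (s≤s ()) _
n%4≡1⇒5≤n {2} _ ()
n%4≡1⇒5≤n {3} _ ()
n%4≡1⇒5≤n {4} _ ()
n%4≡1⇒5≤n {suc (suc (suc (suc (suc n))))} _ _ = s≤s (s≤s (s≤s (s≤s (s≤s z≤n))))

σ[q]*q≢σ[m]*m : ∀ {q m} .{{_ : NonZero m}} → 1 < q → Coprime m q →
  σ q * σ (m * m) ≡ 2 * (q * (m * m)) → σ q * q ≢ σ m * m
σ[q]*q≢σ[m]*m {q} {m} 1<q m⊥q perfect σq*q≡σm*m
  with t , σq≡tm , σm≡tq ← coprime-proportional m⊥q σq*q≡σm*m = excluded t σq≡tm σm≡tq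
  where
  instance
    _ = >-nonZero (<-trans z<s 1<q)
    _ = m*n≢0 m m
    _ = m*n≢0 q (m * m)
  N = q * (m * m)
  excluded : ∀ t → σ q ≡ t * m → σ m ≡ t * q → ⊥
  excluded 0 σq≡0 _ = n≮0 (subst (q <_) σq≡0 (n<σ[n] 1<q))
  excluded 1 σq≡m σm≡q = <-irrefl refl (begin-strict
    q   <⟨ n<σ[n] 1<q ⟩
    σ q ≡⟨ trans σq≡m (*-identityˡ m) ⟩
    m   ≤⟨ n≤σ[n] m ⟩
    σ m ≡⟨ trans σm≡q (*-identityˡ q) ⟩
    q   ∎)
    where open ≤-Reasoning
  excluded t@(suc (suc _)) σq≡tm σm≡tq = <⇒≱ (*-monoˡ-< N {2} {4} (s≤s (s≤s (s≤s z≤n)))) (begin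
    4 * N                 ≤⟨ *-monoˡ-≤ N (*-mono-≤ {2} {t} {2} {t} (s≤s (s≤s z≤n)) (s≤s (s≤s z≤n))) ⟩
    t * t * N             ≡⟨ solve 3 (λ t m q → t :* t :* (q :* (m :* m)) := t :* m :* (m :* (t :* q))) refl t m q ⟩
    t * m * (m * (t * q)) ≡⟨ cong₂ (λ a b → a * (m * b)) σq≡tm σm≡tq ⟨
    σ q * (m * σ m)       ≤⟨ *-monoʳ-≤ (σ q) (m*σ[n]≤σ[m*n] m m) ⟩
    σ q * σ (m * m)       ≡⟨ perfect ⟩
    2 * N                 ∎)
    where open ≤-Reasoning

σ[n]<2*n : ∀ {q n} .{{_ : NonZero n}} → 1 < q → σ q * σ n ≡ 2 * (q * n) → σ n < 2 * n
σ[n]<2*n {q} {n} 1<q perfect = *-cancelˡ-< q (σ n) (2 * n) (begin-strict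
  q * σ n     <⟨ *-monoˡ-< (σ n) (n<σ[n] 1<q) ⟩
  σ q * σ n   ≡⟨ perfect ⟩
  2 * (q * n) ≡⟨ solve 2 (λ q n → con 2 :* (q :* n) := q :* (con 2 :* n)) refl q n ⟩
  q * (2 * n) ∎)
  where
  open ≤-Reasoning
  instance _ = >-nonZero (<-≤-trans (>-nonZero⁻¹ n) (n≤σ[n] n))

q*q<2*m*m : ∀ {q m} .{{_ : NonZero m}} → 1 < q → σ q * σ (m * m) ≡ 2 * (q * (m * m)) →
  σ q * q < σ m * m → q * q < 2 * (m * m)
q*q<2*m*m {q} {m} 1<q perfect σq*q<σm*m = begin-strict
  q * q       <⟨ *-monoˡ-< q (n<σ[n] 1<q) ⟩
  σ q * q     <⟨ σq*q<σm*m ⟩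
  σ m * m     ≡⟨ *-comm (σ m) m ⟩
  m * σ m     ≤⟨ m*σ[n]≤σ[m*n] m m ⟩
  σ (m * m)   <⟨ σ[n]<2*n 1<q perfect ⟩
  2 * (m * m) ∎
  where
  open ≤-Reasoning
  instance
    _ = >-nonZero (<-trans z<s 1<q)
    _ = m*n≢0 m m

σ[q]*σ[m]²<2*q*m² : ∀ {q m} → 4 * σ q < 5 * q → 4 * σ m < 5 * m →
  σ q * (σ m * σ m) < 2 * (q * (m * m))
σ[q]*σ[m]²<2*q*m² {q} {m} 4σq<5q 4σm<5m = *-cancelˡ-< 64 _ _ (begin-strict
  64 * (σ q * (σ m * σ m))
    ≡⟨ solve 2 (λ a b → con 64 :* (a :* (b :* b)) := con 4 :* a :* (con 4 :* b :* (con 4 :* b))) refl (σ q) (σ m) ⟩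
  4 * σ q * (4 * σ m * (4 * σ m)) <⟨ *-mono-< 4σq<5q (*-mono-< 4σm<5m 4σm<5m) ⟩
  5 * q * (5 * m * (5 * m))
    ≡⟨ solve 2 (λ q m → con 5 :* q :* (con 5 :* m :* (con 5 :* m)) := con 125 :* (q :* (m :* m))) refl q m ⟩
  125 * (q * (m * m))             ≤⟨ *-monoˡ-≤ (q * (m * m)) (m≤m+n 125 3) ⟩
  128 * (q * (m * m))
    ≡⟨ solve 1 (λ n → con 128 :* n := con 64 :* (con 2 :* n)) refl (q * (m * m)) ⟩
  64 * (2 * (q * (m * m)))        ∎)
  where open ≤-Reasoning

σ[m]*m<σ[q]*q⇒m<q : ∀ {q m} .{{_ : NonZero m}} → 4 * σ q < 5 * q →
  σ q * σ (m * m) ≡ 2 * (q * (m * m)) → σ m * m < σ q * q → m < q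
σ[m]*m<σ[q]*q⇒m<q {q} {m} 4σq<5q perfect σm*m<σq*q =
  ≰⇒> λ q≤m → <⇒≱ (σ[q]*σ[m]²<2*q*m² {q} {m} 4σq<5q (4σm<5m q≤m)) 2qm²≤σ[q]σ[m]²
  where
  open ≤-Reasoning
  4σm<5m : q ≤ m → 4 * σ m < 5 * m
  4σm<5m q≤m = begin-strict
    4 * σ m <⟨ *-monoʳ-< 4 (*-cancelʳ-< m (σ m) (σ q) (<-≤-trans σm*m<σq*q (*-monoʳ-≤ (σ q) q≤m))) ⟩
    4 * σ q <⟨ 4σq<5q ⟩
    5 * q   ≤⟨ *-monoʳ-≤ 5 q≤m ⟩
    5 * m   ∎
  2qm²≤σ[q]σ[m]² : 2 * (q * (m * m)) ≤ σ q * (σ m * σ m)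
  2qm²≤σ[q]σ[m]² = begin
    2 * (q * (m * m))   ≡⟨ perfect ⟨
    σ q * σ (m * m)     ≤⟨ *-monoʳ-≤ (σ q) (σ[m*n]≤σ[m]*σ[n] m m) ⟩
    σ q * (σ m * σ m)   ∎

-- a ÷ℕ suc b is definitionally fromℚᵘ (mkℚᵘ (+ a) b).
toℚᵘ-÷ℕ : ∀ a b → toℚᵘ (a ÷ℕ suc b [ z<s ]) ≃ᵘ mkℚᵘ (+ a) b
toℚᵘ-÷ℕ a b = toℚᵘ-fromℚᵘ (mkℚᵘ (+ a) b)

÷ℕ-drop-*<* : ∀ {a b c d} {b>0 : 0 < b} {d>0 : 0 < d} →
  a ÷ℕ b [ b>0 ] Q.< c ÷ℕ d [ d>0 ] → a * d < c * b
÷ℕ-drop-*<* {a} {suc b} {c} {suc d} x<y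
  with *<* ad<cb ← ℚᵘ.<-respʳ-≃ (toℚᵘ-÷ℕ c d) (ℚᵘ.<-respˡ-≃ (toℚᵘ-÷ℕ a b) (toℚᵘ-mono-< x<y))
  = ℤ.drop‿+<+ (subst₂ ℤ._<_ (sym (ℤ.pos-* a (suc d))) (sym (ℤ.pos-* c (suc b))) ad<cb)

÷ℕ-*<* : ∀ {a b c d} {b>0 : 0 < b} {d>0 : 0 < d} →
  a * d < c * b → a ÷ℕ b [ b>0 ] Q.< c ÷ℕ d [ d>0 ]
÷ℕ-*<* {a} {suc b} {c} {suc d} ad<cb = toℚᵘ-cancel-<
  (ℚᵘ.<-respʳ-≃ (ℚᵘ.≃-sym (toℚᵘ-÷ℕ c d)) (ℚᵘ.<-respˡ-≃ (ℚᵘ.≃-sym (toℚᵘ-÷ℕ a b))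
    (*<* (subst₂ ℤ._<_ (ℤ.pos-* a (suc d)) (ℤ.pos-* c (suc b)) (ℤ.+<+ ad<cb)))))

÷ℕ-drop-*≡* : ∀ {a b c d} {b>0 : 0 < b} {d>0 : 0 < d} →
  a ÷ℕ b [ b>0 ] ≡ c ÷ℕ d [ d>0 ] → a * d ≡ c * b
÷ℕ-drop-*≡* {a} {suc b} {c} {suc d} x≡y
  with *≡* ad≡cb ← ℚᵘ.≃-trans (ℚᵘ.≃-sym (toℚᵘ-÷ℕ a b)) (ℚᵘ.≃-trans (toℚᵘ-cong x≡y) (toℚᵘ-÷ℕ c d))
  = ℤ.+-injective (trans (ℤ.pos-* a (suc d)) (trans ad≡cb (sym (ℤ.pos-* c (suc b)))))

÷ℕ-* : ∀ {a b c d} {b>0 : 0 < b} {d>0 : 0 < d} →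
  a ÷ℕ b [ b>0 ] Q.* c ÷ℕ d [ d>0 ] ≡ (a * c) ÷ℕ (b * d) [ *-mono-< b>0 d>0 ]
÷ℕ-* {a} {suc b} {c} {suc d} = toℚᵘ-injective
  (ℚᵘ.≃-trans (toℚᵘ-homo-* (a ÷ℕ suc b [ z<s ]) (c ÷ℕ suc d [ z<s ]))
  (ℚᵘ.≃-trans (ℚᵘ.*-cong (toℚᵘ-÷ℕ a b) (toℚᵘ-÷ℕ c d))
  (ℚᵘ.≃-trans (*≡* (cong (ℤ._* + suc (d + b * suc d)) (sym (ℤ.pos-* a c))))
    (ℚᵘ.≃-sym (toℚᵘ-÷ℕ (a * c) (d + b * suc d))))))

ρ₃-drop-*≡*-μ₄ : ∀ p k m mpos pp → ρ₃ p k m mpos ≡ μ₄ p k m pp → σ (p ^ k) * p ^ k ≡ σ m * m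
ρ₃-drop-*≡*-μ₄ p k m mpos pp =
  ÷ℕ-drop-*≡* {σ (p ^ k)} {m} {σ m} {p ^ k} {mpos} {m^n>0 p {{prime⇒nonZero pp}} k}

ρ₃-drop-*<*-μ₄ : ∀ p k m mpos pp → ρ₃ p k m mpos Q.< μ₄ p k m pp → σ (p ^ k) * p ^ k < σ m * m
ρ₃-drop-*<*-μ₄ p k m mpos pp =
  ÷ℕ-drop-*<* {σ (p ^ k)} {m} {σ m} {p ^ k} {mpos} {m^n>0 p {{prime⇒nonZero pp}} k}

μ₄-drop-*<*-ρ₃ : ∀ p k m mpos pp → μ₄ p k m pp Q.< ρ₃ p k m mpos → σ m * m < σ (p ^ k) * p ^ k
μ₄-drop-*<*-ρ₃ p k m mpos pp =
  ÷ℕ-drop-*<* {σ m} {p ^ k} {σ (p ^ k)} {m} {m^n>0 p {{prime⇒nonZero pp}} k} {mpos}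

ρ₃<1⇒σ[pᵏ]<m : ∀ p k m mpos → ρ₃ p k m mpos Q.< 1ℚ → σ (p ^ k) < m
ρ₃<1⇒σ[pᵏ]<m p k m mpos ρ₃<1 = subst₂ _<_ (*-identityʳ (σ (p ^ k))) (*-identityˡ m)
  (÷ℕ-drop-*<* {σ (p ^ k)} {m} {1} {1} {mpos} {z<s} ρ₃<1)

1<ρ₃⇒m<σ[pᵏ] : ∀ p k m mpos → 1ℚ Q.< ρ₃ p k m mpos → m < σ (p ^ k)
1<ρ₃⇒m<σ[pᵏ] p k m mpos 1<ρ₃ = subst₂ _<_ (*-identityˡ m) (*-identityʳ (σ (p ^ k)))
  (÷ℕ-drop-*<* {1} {1} {σ (p ^ k)} {m} {z<s} {mpos} 1<ρ₃)

4*m<5*q⇒4/5*m<q : ∀ m q → 4 * m < 5 * q → (+ 4) Q./ 5 Q.* ℕtoℚ m Q.< ℕtoℚ q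
4*m<5*q⇒4/5*m<q m q 4m<5q = subst (Q._< ℕtoℚ q) (sym (÷ℕ-* {4} {5} {m} {1} {z<s} {z<s}))
  (÷ℕ-*<* {4 * m} {5} {q} {1} {z<s} {z<s} (subst₂ _<_ (sym (*-identityʳ (4 * m))) (*-comm 5 q) 4m<5q))

q*q<2*m*m⇒[q/m]²<2 : ∀ q m (mpos : 0 < m) → q * q < 2 * (m * m) →
  q ÷ℕ m [ mpos ] Q.* q ÷ℕ m [ mpos ] Q.< ℕtoℚ 2
q*q<2*m*m⇒[q/m]²<2 q m mpos q²<2m² = subst (Q._< ℕtoℚ 2) (sym (÷ℕ-* {q} {m} {q} {m} {mpos} {mpos}))
  (÷ℕ-*<* {q * q} {m * m} {2} {1} {*-mono-< mpos mpos} {z<s}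
    (subst (_< 2 * (m * m)) (sym (*-identityʳ (q * q))) q²<2m²))

theorem4p2p4 : (N p k m : ℕ) (pp : Prime p) (kpos : 0 N.< k) (mpos : 0 N.< m) →
    p % 4 ≡ 1 → k % 4 ≡ 1 → Coprime p m →
    N ≡ p ^ k * (m * m) → N % 2 ≡ 1 → σ N ≡ 2 * N →
    ρ₃ p k m mpos ≢ μ₄ p k m pp
      × (ρ₃ p k m mpos Q.< 1ℚ → p ^ k N.< m)
      × (1ℚ Q.< ρ₃ p k m mpos → ρ₃ p k m mpos Q.< μ₄ p k m pp →
           (((+ 4) Q./ 5) Q.* ℕtoℚ m Q.< ℕtoℚ (p ^ k))
           × (((p ^ k) ÷ℕ m [ mpos ]) Q.* ((p ^ k) ÷ℕ m [ mpos ]) Q.< ℕtoℚ 2))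
      × (1ℚ Q.< ρ₃ p k m mpos → μ₄ p k m pp Q.< ρ₃ p k m mpos → m N.< p ^ k)
theorem4p2p4 _ p k m pp 0<k 0<m p%4≡1 _ p⊥m refl _ σ[N]≡2N =
    (λ ρ≡μ → σ[q]*q≢σ[m]*m 1<q m⊥q perfect (ρ₃-drop-*≡*-μ₄ p k m 0<m pp ρ≡μ))
  , (λ ρ<1 → <-trans (n<σ[n] 1<q) (ρ₃<1⇒σ[pᵏ]<m p k m 0<m ρ<1))
  , (λ 1<ρ ρ<μ →
         4*m<5*q⇒4/5*m<q m q (<-trans (*-monoʳ-< 4 (1<ρ₃⇒m<σ[pᵏ] p k m 0<m 1<ρ)) 4σ[q]<5q)
       , q*q<2*m*m⇒[q/m]²<2 q m 0<m (q*q<2*m*m 1<q perfect (ρ₃-drop-*<*-μ₄ p k m 0<m pp ρ<μ)))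
  , (λ _ μ<ρ → σ[m]*m<σ[q]*q⇒m<q 4σ[q]<5q perfect (μ₄-drop-*<*-ρ₃ p k m 0<m pp μ<ρ))
  where
  q = p ^ k
  instance
    _ = >-nonZero 0<m
    _ = m^n≢0 p k {{prime⇒nonZero pp}}
    _ = m*n≢0 m m
  1<p : 1 < p
  1<p = nonTrivial⇒n>1 p {{prime⇒nonTrivial pp}}
  1<q : 1 < q
  1<q = ^-monoʳ-< p 1<p 0<k
  m⊥q : Coprime m q
  m⊥q = coprime-^ k (Coprime.sym p⊥m)
  perfect : σ q * σ (m * m) ≡ 2 * (q * (m * m))
  perfect = trans (sym (σ-multiplicative (coprime-* (Coprime.sym m⊥q) (Coprime.sym m⊥q)))) σ[N]≡2N
  4σ[q]<5q : 4 * σ q < 5 * q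
  4σ[q]<5q = 4*σ[p^k]<5*p^k k pp (n%4≡1⇒5≤n 1<p p%4≡1)
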